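{- Let $L$ be a bounded lattice, $\mathrm{V}$ a join-dense set of elements of $L$, and $\Lambda$ a meet-dense set of elements of $L$. For a set $P$ of pairs of elements of $L$, define $\vartriangleleft$ on $P$ by $(a,b)\vartriangleleft(c,d)$ iff $c\not\le b$. (1) If $\neg$ is a precomplementation on $L$, then with $P=\{(a,\neg a)\mid a\in L\}\cup\{(1,b)\mid b\in\Lambda\}$, there is a complete embedding of $(L,\neg)$ into $(\mathfrak{L}(P,\vartriangleleft),\neg_\vartriangleleft)$. (2) If $\neg$ is a protocomplementation on $L$, then with $P=\{(a,\neg a)\mid a\in L, a\ne0\}\cup\{(1,b)\mid b\in\Lambda, b\ne1\}$, there is a complete embedding of $(L,\neg)$ into $(\mathfrak{L}(P,\vartriangleleft),\neg_\vartriangleleft)$, and $\vartriangleleft$ is reflexive. (3) If $\neg$ is an ultraweak pseudocomplementation on $L$, then with $P=\{(a,\neg a)\mid a\in\mathrm{V}\}\cup\{(1,b)\mid b\in\Lambda\}$, there is a complete embedding of $(L,\neg)$ into $(\mathfrak{L}(P,\vartriangleleft),\neg_\vartriangleleft)$, and $\vartriangleleft$ is pseudosymmetric (and strongly pseudosymmetric if $\mathrm{V}=L$). (4) If $\neg$ is a weak pseudocomplementation on $L$, then with $P=\{(a,\neg a)\mid a\in\mathrm{V}, a\ne0\}\cup\{(1,b)\mid b\in\Lambda, b\ne1\}$, there is a complete embedding of $(L,\neg)$ into $(\mathfrak{L}(P,\vartriangleleft),\neg_\vartriangleleft)$, and $\vartriangleleft$ is reflexive and pseudosymmetric (and strongly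 pseudosymmetric if $\mathrm{V}=L$). Moreover, if $\neg$ is a pseudocomplementation, then $\vartriangleleft$ is weakly compossible. In each case, if $L$ is complete, then the embedding is an isomorphism.
   Context: A set $S\subseteq L$ is join-dense (resp. meet-dense) if every element of $L$ is the join (resp. meet) of some subset of $S$. Negation types on a bounded lattice: a precomplementation is an antitone ($a\le b\Rightarrow\neg b\le\neg a$) unary operation with $\neg1=0$; a protocomplementation is antitone with $a\wedge\neg a=0$ for all $a$ and $\neg0=1$; an ultraweak pseudocomplementation is antitone with $a\le\neg\neg a$ for all $a$ and $\neg1=0$; a weak pseudocomplementation is antitone with $a\wedge\neg a=0$ and $a\le\neg\neg a$ for all $a$; a pseudocomplementation sends each $a$ to the maximum of $\{y\mid a\wedge y=0\}$. For a nonempty set $X$ with binary relation $\vartriangleleft$ (write $y\vartriangleright x$ for $x\vartriangleleft y$): $c_\vartriangleleft(A)=\{x\mid\forall x'\vartriangleleft x\ \exists x''\vartriangleright x':x''\in A\}$; $\mathfrak{L}(X,\vartriangleleft)$ is the complete lattice of sets $A$ with $c_\vartriangleleft(A)=A$ ordered by inclusion (meets are intersections, joins are $c_\vartriangleleft$ of unions); $\neg_\vartriangleleft A=\{x\mid\forall y\vartriangleleft x,\ y\notin A\}$. $x$ is absurd if no $y$ satisfies $y\vartriangleleft x$. $x$ pre-refines $y$ if $z\vartriangleleft x$ implies $z\vartriangleleft y$ for all $z$. $\vartriangleleft$ is pseudosymmetric if for all $x$ and $y\vartriangleleft x$ there is $z\vartriangleleft y$ pre-refining $x$; strongly pseudosymmetric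 if for all $x$ and $y\vartriangleleft x$ there is $z\vartriangleleft y$ such that $z$ pre-refines $x$ and $x$ pre-refines $z$; weakly compossible if for all $x$ and $y\vartriangleleft x$ there is a non-absurd $z$ pre-refining both $y$ and $x$. A complete embedding of $(L,\neg)$ into $(L',\neg')$ is an injective map preserving all existing meets and joins of $L$ and commuting with negation. -}

module Defs where

open import Level using (Level; _⊔_; suc)
open import Data.Product using (Σ; ∃; _×_; _,_; proj₁; proj₂)
open import Data.Sum using (_⊎_)
open import Relation.Nullary using (¬_)
open import Relation.Unary using (Pred; _⊆_; _∈_)
open import Relation.Binary using (Rel)
open import Relation.Binary.Lattice.Bundles using (BoundedLattice)

private variable ℓ : Level

_≐_ : {X : Set ℓ} → Pred X ℓ → Pred X ℓ → Set ℓ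
A ≐ B = (A ⊆ B) × (B ⊆ A)

module _ {X : Set ℓ} (_◁_ : Rel X ℓ) where

  closure : Pred X ℓ → Pred X ℓ
  closure A x = ∀ x' → x' ◁ x → ∃ λ x'' → (x' ◁ x'') × A x''

  -- A is an element of 𝔏(X, ◁) iff c_◁(A) = A
  IsFixed : Pred X ℓ → Set ℓ
  IsFixed A = closure A ≐ A

  neg◁ : Pred X ℓ → Pred X ℓ
  neg◁ A x = ∀ y → y ◁ x → ¬ A y

  IsReflexive : Set ℓ
  IsReflexive = ∀ x → x ◁ x

  Absurd : X → Set ℓ
  Absurd x = ∀ y → ¬ (y ◁ x)

  PreRefines : X → X → Set ℓ
  PreRefines x y = ∀ z → z ◁ x → z ◁ y

  Pseudosymmetric : Set ℓ
  Pseudosymmetric = ∀ x y → y ◁ x → ∃ λ z → (z ◁ y) × PreRefines z x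

  StronglyPseudosymmetric : Set ℓ
  StronglyPseudosymmetric =
    ∀ x y → y ◁ x → ∃ λ z → (z ◁ y) × PreRefines z x × PreRefines x z

  WeaklyCompossible : Set ℓ
  WeaklyCompossible =
    ∀ x y → y ◁ x → ∃ λ z → (¬ Absurd z) × PreRefines z y × PreRefines z x

module _ (L : BoundedLattice ℓ ℓ ℓ) where
  open BoundedLattice L

  IsJoinOf : Pred Carrier ℓ → Carrier → Set ℓ
  IsJoinOf S a = (∀ s → S s → s ≤ a) × (∀ u → (∀ s → S s → s ≤ u) → a ≤ u)

  IsMeetOf : Pred Carrier ℓ → Carrier → Set ℓ
  IsMeetOf S a = (∀ s → S s → a ≤ s) × (∀ u → (∀ s → S s → u ≤ s) → u ≤ a)

  JoinDense : Pred Carrier ℓ → Set (suc ℓ)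
  JoinDense D = ∀ a → ∃ λ (S : Pred Carrier ℓ) → (S ⊆ D) × IsJoinOf S a

  MeetDense : Pred Carrier ℓ → Set (suc ℓ)
  MeetDense D = ∀ a → ∃ λ (S : Pred Carrier ℓ) → (S ⊆ D) × IsMeetOf S a

  IsComplete : Set (suc ℓ)
  IsComplete = ∀ (S : Pred Carrier ℓ) → ∃ λ a → IsJoinOf S a

  Antitone : (Carrier → Carrier) → Set ℓ
  Antitone n = ∀ a b → a ≤ b → n b ≤ n a

  IsPrecomplementation : (Carrier → Carrier) → Set ℓ
  IsPrecomplementation n = Antitone n × (n ⊤ ≈ ⊥)

  IsProtocomplementation : (Carrier → Carrier) → Set ℓ
  IsProtocomplementation n = Antitone n × (∀ a → (a ∧ n a) ≈ ⊥) × (n ⊥ ≈ ⊤)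

  IsUltraweakPseudocomplementation : (Carrier → Carrier) → Set ℓ
  IsUltraweakPseudocomplementation n =
    Antitone n × (∀ a → a ≤ n (n a)) × (n ⊤ ≈ ⊥)

  IsWeakPseudocomplementation : (Carrier → Carrier) → Set ℓ
  IsWeakPseudocomplementation n =
    Antitone n × (∀ a → (a ∧ n a) ≈ ⊥) × (∀ a → a ≤ n (n a))

  IsPseudocomplementation : (Carrier → Carrier) → Set ℓ
  IsPseudocomplementation n =
    ∀ a → ((a ∧ n a) ≈ ⊥) × (∀ y → (a ∧ y) ≈ ⊥ → y ≤ n a)

  Pair : Set ℓ
  Pair = Carrier × Carrier

  NegPairs : (Carrier → Carrier) → Pred Carrier ℓ → Pred Pair ℓ
  NegPairs n D p = ∃ λ a → D a × (proj₁ p ≈ a) × (proj₂ p ≈ n a)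

  TopPairs : Pred Carrier ℓ → Pred Pair ℓ
  TopPairs D p = ∃ λ b → D b × (proj₁ p ≈ ⊤) × (proj₂ p ≈ b)

  PairSet : (Carrier → Carrier) → Pred Carrier ℓ → Pred Carrier ℓ → Pred Pair ℓ
  PairSet n D₁ D₂ p = NegPairs n D₁ p ⊎ TopPairs D₂ p

  Elt : Pred Pair ℓ → Set ℓ
  Elt P = Σ Pair P

  _◁_ : {P : Pred Pair ℓ} → Rel (Elt P) ℓ
  ((a , b) , _) ◁ ((c , d) , _) = ¬ (c ≤ b)

  Everything : Pred Carrier ℓ
  Everything _ = Lift-⊤
    where open import Data.Unit.Polymorphic using () renaming (⊤ to Lift-⊤)

  NonZero : Pred Carrier ℓ → Pred Carrier ℓ
  NonZero D a = D a × ¬ (a ≈ ⊥)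

  NonOne : Pred Carrier ℓ → Pred Carrier ℓ
  NonOne D a = D a × ¬ (a ≈ ⊤)

  module _ (n : Carrier → Carrier) (P : Pred Pair ℓ) where

    private
      R : Rel (Elt P) ℓ
      R = _◁_ {P}

    record IsCompleteEmbedding (f : Carrier → Pred (Elt P) ℓ) : Set (suc ℓ) where
      field
        fixed      : ∀ a → IsFixed R (f a)
        respects   : ∀ a b → a ≈ b → f a ≐ f b
        injective  : ∀ a b → f a ≐ f b → a ≈ b
        pres-meets : ∀ (S : Pred Carrier ℓ) m → IsMeetOf S m →
                       (∀ s → S s → f m ⊆ f s) ×
                       (∀ B → IsFixed R B → (∀ s → S s → B ⊆ f s) → B ⊆ f m)
        pres-joins : ∀ (S : Pred Carrier ℓ) m → IsJoinOf S m →
                       (∀ s → S s → f s ⊆ f m) ×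
                       (∀ B → IsFixed R B → (∀ s → S s → f s ⊆ B) → f m ⊆ B)
        pres-neg   : ∀ a → f (n a) ≐ neg◁ R (f a)

    IsOnto : (Carrier → Pred (Elt P) ℓ) → Set (suc ℓ)
    IsOnto f = ∀ (B : Pred (Elt P) ℓ) → IsFixed R B → ∃ λ a → f a ≐ B

    EmbeddingResult : Set (suc ℓ)
    EmbeddingResult = ∃ λ f → IsCompleteEmbedding f × (IsComplete → IsOnto f)

{-# OPTIONS --safe #-}
module Submission where

open import Defs
open import Level using (Level)
open import Function using (id)
open import Data.Product using (_×_; ∃; _,_; proj₁; proj₂)
open import Data.Sum using (_⊎_; inj₁; inj₂; [_,_])
open import Data.Unit.Polymorphic using (tt)
open import Relation.Nullary using (¬_; yes; no)
open import Relation.Unary using (Pred; _⊆_)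
open import Relation.Binary using (Rel)
open import Relation.Binary.Lattice.Bundles using (BoundedLattice)
open import Axiom.ExcludedMiddle using (ExcludedMiddle)
open import Axiom.DoubleNegationElimination using (em⇒dne)

-- An element a is represented by the set ↓ a of pairs whose first component
-- lies below a.  The first components of P are join-dense, so a ↦ ↓ a is an
-- order embedding preserving joins; the second components are meet-dense, which
-- makes every ↓ a closed and forces each closed set to be the ↓ of the join of
-- its first components.  Negation is preserved because n a is the meet of the
-- second components of the pairs below a.  The frame conditions on ◁ are
-- witnessed by pairs (t , n t) with t taken from the join-dense set.

module NegationRepresentation {ℓ : Level} (em : ExcludedMiddle ℓ)
  (L : BoundedLattice ℓ ℓ ℓ) (n : BoundedLattice.Carrier L → BoundedLattice.Carrier L) where

  open BoundedLattice L

  ¬¬-elim : {A : Set ℓ} → ¬ ¬ A → A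
  ¬¬-elim = em⇒dne em

  ≰⇒≉⊥ : ∀ {a b} → ¬ a ≤ b → ¬ a ≈ ⊥
  ≰⇒≉⊥ a≰b a≈⊥ = a≰b (trans (reflexive a≈⊥) (minimum _))

  ≰⇒≉⊤ : ∀ {a b} → ¬ a ≤ b → ¬ b ≈ ⊤
  ≰⇒≉⊤ a≰b b≈⊤ = a≰b (trans (maximum _) (reflexive (Eq.sym b≈⊤)))

  below-disjoint⇒≈⊥ : ∀ {a b c} → (a ∧ b) ≈ ⊥ → c ≤ a → c ≤ b → c ≈ ⊥
  below-disjoint⇒≈⊥ a∧b≈⊥ c≤a c≤b =
    antisym (trans (∧-greatest c≤a c≤b) (reflexive a∧b≈⊥)) (minimum _)

  join-witness : ∀ {S m b} → IsJoinOf L S m → ¬ m ≤ b → ∃ λ s → S s × ¬ s ≤ b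
  join-witness {b = b} (_ , least) m≰b =
    ¬¬-elim λ ∄ → m≰b (least b λ s s∈S → ¬¬-elim λ s≰b → ∄ (s , s∈S , s≰b))

  meet-witness : ∀ {S m c} → IsMeetOf L S m → ¬ c ≤ m → ∃ λ s → S s × ¬ c ≤ s
  meet-witness {c = c} (_ , greatest) c≰m =
    ¬¬-elim λ ∄ → c≰m (greatest c λ s s∈S → ¬¬-elim λ c≰s → ∄ (s , s∈S , c≰s))

  joinDense-witness : ∀ {V} → JoinDense L V →
                      ∀ {s b} → ¬ s ≤ b → ∃ λ t → V t × t ≤ s × ¬ t ≤ b
  joinDense-witness jd {s} s≰b =
    let (T , T⊆V , join) = jd s
        (t , t∈T , t≰b) = join-witness join s≰b
    in t , T⊆V t∈T , proj₁ join t t∈T , t≰b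

  everything-joinDense : JoinDense L (Everything L)
  everything-joinDense a =
    (_≈ a) , (λ _ → tt) , (λ _ → reflexive) , (λ _ upper → upper a Eq.refl)

  disjoint⇒neg⊤≈⊥ : (∀ a → (a ∧ n a) ≈ ⊥) → n ⊤ ≈ ⊥
  disjoint⇒neg⊤≈⊥ disjoint = below-disjoint⇒≈⊥ (disjoint ⊤) (maximum _) refl

  protocomplementation⇒precomplementation :
    IsProtocomplementation L n → IsPrecomplementation L n
  protocomplementation⇒precomplementation (antitone , disjoint , _) =
    antitone , disjoint⇒neg⊤≈⊥ disjoint

  ultraweak⇒precomplementation :
    IsUltraweakPseudocomplementation L n → IsPrecomplementation L n
  ultraweak⇒precomplementation (antitone , _ , n⊤≈⊥) = antitone , n⊤≈⊥

  weak⇒ultraweak :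
    IsWeakPseudocomplementation L n → IsUltraweakPseudocomplementation L n
  weak⇒ultraweak (antitone , disjoint , involutive) =
    antitone , involutive , disjoint⇒neg⊤≈⊥ disjoint

  nonzero-or-neg⊤ : IsProtocomplementation L n →
                    ∀ a → NonZero L (Everything L) a ⊎ ⊤ ≤ n a
  nonzero-or-neg⊤ (antitone , _ , n⊥≈⊤) a with em {a ≈ ⊥}
  ... | yes a≈⊥ = inj₂ (trans (reflexive (Eq.sym n⊥≈⊤)) (antitone _ _ (reflexive a≈⊥)))
  ... | no a≉⊥  = inj₁ (tt , a≉⊥)

  module Pairs (P : Pred (Pair L) ℓ) where

    infix 4 _◁ᴾ_
    _◁ᴾ_ : Rel (Elt L P) ℓ
    _◁ᴾ_ = _◁_ L {P}

    fst snd : Elt L P → Carrier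
    fst p = proj₁ (proj₁ p)
    snd p = proj₂ (proj₁ p)

    ↓ : Carrier → Pred (Elt L P) ℓ
    ↓ a p = fst p ≤ a

    fst≤⇒preRefines : ∀ z x → fst z ≤ fst x → PreRefines _◁ᴾ_ z x
    fst≤⇒preRefines _ _ z≤x _ w◁z x≤w = w◁z (trans z≤x x≤w)

    fixed-downClosed : ∀ {B} → IsFixed _◁ᴾ_ B → ∀ {p q} → fst q ≤ fst p → B p → B q
    fixed-downClosed fixed {p} {q} q≤p p∈B =
      proj₁ fixed λ w w◁q → p , fst≤⇒preRefines q p q≤p w w◁q , p∈B

    record IsRepresenting : Set ℓ where
      field
        snd-separates : ∀ {a c} → ¬ c ≤ a → ∃ λ p → a ≤ snd p × ¬ c ≤ snd p
        fst-separates : ∀ {s b} → ¬ s ≤ b → ∃ λ p → fst p ≤ s × ¬ fst p ≤ b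
        neg-fst≤snd   : ∀ p → n (fst p) ≤ snd p
        neg-greatest  : ∀ {a c} → (∀ p → fst p ≤ a → c ≤ snd p) → c ≤ n a

    module _ (antitone : Antitone L n) (rep : IsRepresenting) where
      open IsRepresenting rep

      ↓-fixed : ∀ a → IsFixed _◁ᴾ_ (↓ a)
      ↓-fixed a = (λ {x} → closed {x}) , (λ {x} x≤a w w◁x → x , w◁x , x≤a)
        where
        closed : closure _◁ᴾ_ (↓ a) ⊆ ↓ a
        closed {x} x∈cl = ¬¬-elim λ x≰a →
          let (p , a≤p , x≰p) = snd-separates x≰a
              (q , p◁q , q≤a) = x∈cl p x≰p
          in p◁q (trans q≤a a≤p)

      ↓-reflects-≤ : ∀ {a b} → ↓ a ⊆ ↓ b → a ≤ b
      ↓-reflects-≤ a⊆b = ¬¬-elim λ a≰b →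
        let (p , p≤a , p≰b) = fst-separates a≰b in p≰b (a⊆b {p} p≤a)

      ↓-join-least : ∀ {S m B} → IsJoinOf L S m → IsFixed _◁ᴾ_ B →
                     (∀ s → S s → ↓ s ⊆ B) → ↓ m ⊆ B
      ↓-join-least join fixed below {x} x≤m = proj₁ fixed λ w w◁x →
        let (s , s∈S , s≰w) = join-witness join (λ m≤w → w◁x (trans x≤m m≤w))
            (p , p≤s , p≰w) = fst-separates s≰w
        in p , p≰w , below s s∈S p≤s

      ↓-isCompleteEmbedding : IsCompleteEmbedding L n P ↓
      ↓-isCompleteEmbedding = record
        { fixed      = ↓-fixed
        ; respects   = λ _ _ a≈b → (λ x≤a → trans x≤a (reflexive a≈b))
                                 , (λ x≤b → trans x≤b (reflexive (Eq.sym a≈b)))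
        ; injective  = λ _ _ (a⊆b , b⊆a) →
            antisym (↓-reflects-≤ (λ {x} → a⊆b {x})) (↓-reflects-≤ (λ {x} → b⊆a {x}))
        ; pres-meets = λ _ _ (lower , greatest) →
            (λ s s∈S x≤m → trans x≤m (lower s s∈S)) ,
            (λ _ _ B⊆ {x} x∈B → greatest (fst x) λ s s∈S → B⊆ s s∈S x∈B)
        ; pres-joins = λ _ _ join →
            (λ s s∈S x≤s → trans x≤s (proj₁ join s s∈S)) ,
            (λ _ fixed below → ↓-join-least join fixed below)
        ; pres-neg   = λ a →
            (λ {x} x≤na y y◁x y≤a →
               y◁x (trans x≤na (trans (antitone _ _ y≤a) (neg-fst≤snd y)))) ,
            (λ {x} x∈neg → neg-greatest λ p p≤a → ¬¬-elim λ x≰p → x∈neg p x≰p p≤a)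
        }

      ↓-onto : IsComplete L → IsOnto L n P ↓
      ↓-onto complete B fixed =
        let (a , join) = complete firsts
        in a , ↓-join-least join fixed below
             , (λ {p} p∈B → proj₁ join (fst p) (p , p∈B , Eq.refl))
        where
        firsts : Pred Carrier ℓ
        firsts c = ∃ λ p → B p × fst p ≈ c
        below : ∀ c → firsts c → ↓ c ⊆ B
        below c (p , p∈B , p≈c) q≤c =
          fixed-downClosed fixed (trans q≤c (reflexive (Eq.sym p≈c))) p∈B

      embeddingResult : EmbeddingResult L n P
      embeddingResult = ↓ , ↓-isCompleteEmbedding , ↓-onto

  module PairSetFacts (D₁ D₂ : Pred Carrier ℓ) where
    open Pairs (PairSet L n D₁ D₂) public

    negPair : ∀ {a} → D₁ a → Elt L (PairSet L n D₁ D₂)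
    negPair {a} a∈D₁ = (a , n a) , inj₁ (a , a∈D₁ , Eq.refl , Eq.refl)

    pairs-neg-fst≤snd : IsPrecomplementation L n → ∀ p → n (fst p) ≤ snd p
    pairs-neg-fst≤snd (antitone , _) (_ , inj₁ (_ , _ , c≈a , d≈na)) =
      trans (antitone _ _ (reflexive (Eq.sym c≈a))) (reflexive (Eq.sym d≈na))
    pairs-neg-fst≤snd (antitone , n⊤≈⊥) (_ , inj₂ (_ , _ , c≈⊤ , _)) =
      trans (antitone _ _ (reflexive (Eq.sym c≈⊤))) (trans (reflexive n⊤≈⊥) (minimum _))

    meetDense⇒snd-separates : ∀ {Λ} → MeetDense L Λ → NonOne L Λ ⊆ D₂ →
                              ∀ {a c} → ¬ c ≤ a → ∃ λ p → a ≤ snd p × ¬ c ≤ snd p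
    meetDense⇒snd-separates md Λ⊆D₂ {a} c≰a =
      let (S , S⊆Λ , meet) = md a
          (s , s∈S , c≰s) = meet-witness meet c≰a
          s∈D₂ = Λ⊆D₂ (S⊆Λ s∈S , ≰⇒≉⊤ c≰s)
      in ((⊤ , s) , inj₂ (s , s∈D₂ , Eq.refl , Eq.refl)) , proj₁ meet s s∈S , c≰s

    joinDense⇒fst-separates : ∀ {V} → JoinDense L V → NonZero L V ⊆ D₁ →
                              ∀ {s b} → ¬ s ≤ b → ∃ λ p → fst p ≤ s × ¬ fst p ≤ b
    joinDense⇒fst-separates jd V⊆D₁ s≰b =
      let (t , t∈V , t≤s , t≰b) = joinDense-witness jd s≰b
      in negPair (V⊆D₁ (t∈V , ≰⇒≉⊥ t≰b)) , t≤s , t≰b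

    precomplementation-embeddingResult :
      IsPrecomplementation L n → ∀ {Λ} → MeetDense L Λ → NonOne L Λ ⊆ D₂ →
      NonZero L (Everything L) ⊆ D₁ → (∀ a → D₁ a ⊎ ⊤ ≤ n a) →
      EmbeddingResult L n (PairSet L n D₁ D₂)
    precomplementation-embeddingResult pre md Λ⊆D₂ L⊆D₁ cover =
      embeddingResult (proj₁ pre) record
        { snd-separates = meetDense⇒snd-separates md Λ⊆D₂
        ; fst-separates = joinDense⇒fst-separates everything-joinDense L⊆D₁
        ; neg-fst≤snd   = pairs-neg-fst≤snd pre
        ; neg-greatest  = λ {a} {c} below →
            [ (λ a∈D₁ → below (negPair a∈D₁) refl) , trans (maximum c) ] (cover a)
        }

    -- An ultraweak pseudocomplementation is self-adjoint: c ≤ n t iff t ≤ n c.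
    ultraweak-neg-greatest :
      IsUltraweakPseudocomplementation L n → ∀ {V} → JoinDense L V → NonZero L V ⊆ D₁ →
      ∀ {a c} → (∀ p → fst p ≤ a → c ≤ snd p) → c ≤ n a
    ultraweak-neg-greatest (antitone , involutive , _) {V} jd V⊆D₁ {a} {c} below =
      trans (involutive c) (antitone _ _ a≤nc)
      where
      t≤nc : ∀ t → V t → t ≤ a → t ≤ n c
      t≤nc t t∈V t≤a with em {t ≈ ⊥}
      ... | yes t≈⊥ = trans (reflexive t≈⊥) (minimum _)
      ... | no t≉⊥  =
        trans (involutive t) (antitone _ _ (below (negPair (V⊆D₁ (t∈V , t≉⊥))) t≤a))
      a≤nc : a ≤ n c
      a≤nc = let (T , T⊆V , upper , least) = jd a
             in least (n c) λ t t∈T → t≤nc t (T⊆V t∈T) (upper t t∈T)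

    ultraweak-embeddingResult :
      IsUltraweakPseudocomplementation L n → ∀ {Λ V} → MeetDense L Λ → NonOne L Λ ⊆ D₂ →
      JoinDense L V → NonZero L V ⊆ D₁ → EmbeddingResult L n (PairSet L n D₁ D₂)
    ultraweak-embeddingResult uw md Λ⊆D₂ jd V⊆D₁ =
      embeddingResult (proj₁ uw) record
        { snd-separates = meetDense⇒snd-separates md Λ⊆D₂
        ; fst-separates = joinDense⇒fst-separates jd V⊆D₁
        ; neg-fst≤snd   = pairs-neg-fst≤snd (ultraweak⇒precomplementation uw)
        ; neg-greatest  = ultraweak-neg-greatest uw jd V⊆D₁
        }

    ◁-reflexive : (∀ a → (a ∧ n a) ≈ ⊥) → (∀ {a} → D₁ a → ¬ a ≈ ⊥) →
                  (∀ {b} → D₂ b → ¬ b ≈ ⊤) → IsReflexive _◁ᴾ_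
    ◁-reflexive disjoint nonzero _ (_ , inj₁ (a , a∈D₁ , c≈a , d≈na)) c≤d =
      nonzero a∈D₁ (below-disjoint⇒≈⊥ (disjoint a) refl
                      (trans (reflexive (Eq.sym c≈a)) (trans c≤d (reflexive d≈na))))
    ◁-reflexive _ _ nonone (_ , inj₂ (b , b∈D₂ , c≈⊤ , d≈b)) c≤d =
      nonone b∈D₂ (antisym (maximum b)
                      (trans (reflexive (Eq.sym c≈⊤)) (trans c≤d (reflexive d≈b))))

    negPair-◁ : IsUltraweakPseudocomplementation L n →
                ∀ {t} (t∈D₁ : D₁ t) y → ¬ t ≤ snd y → negPair t∈D₁ ◁ᴾ y
    negPair-◁ uw@(antitone , involutive , _) {t} _ y t≰y y≤nt =
      t≰y (trans (involutive t)
            (trans (antitone _ _ y≤nt)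
              (pairs-neg-fst≤snd (ultraweak⇒precomplementation uw) y)))

    pseudosymmetric : IsUltraweakPseudocomplementation L n →
                      ∀ {V} → JoinDense L V → NonZero L V ⊆ D₁ → Pseudosymmetric _◁ᴾ_
    pseudosymmetric uw jd V⊆D₁ x y y◁x =
      let (t , t∈V , t≤x , t≰y) = joinDense-witness jd y◁x
          t∈D₁ = V⊆D₁ (t∈V , ≰⇒≉⊥ t≰y)
      in negPair t∈D₁ , negPair-◁ uw t∈D₁ y t≰y , fst≤⇒preRefines (negPair t∈D₁) x t≤x

    stronglyPseudosymmetric : IsUltraweakPseudocomplementation L n →
                              (∀ {a} → ¬ a ≈ ⊥ → D₁ a) → StronglyPseudosymmetric _◁ᴾ_
    stronglyPseudosymmetric uw nonzero⊆D₁ x y y◁x =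
      let x∈D₁ = nonzero⊆D₁ (≰⇒≉⊥ y◁x)
      in negPair x∈D₁ , negPair-◁ uw x∈D₁ y y◁x
       , fst≤⇒preRefines (negPair x∈D₁) x refl , fst≤⇒preRefines x (negPair x∈D₁) refl

    ◁⇒fst-∧≰⊥ : IsPseudocomplementation L n → ∀ x y → y ◁ᴾ x → ¬ (fst x ∧ fst y) ≤ ⊥
    ◁⇒fst-∧≰⊥ pc x (_ , inj₁ (a , _ , c≈a , d≈na)) y◁x x∧c≤⊥ =
      y◁x (trans (proj₂ (pc a) (fst x) a∧x≈⊥) (reflexive (Eq.sym d≈na)))
      where
      a∧x≈⊥ : (a ∧ fst x) ≈ ⊥
      a∧x≈⊥ = below-disjoint⇒≈⊥ (antisym x∧c≤⊥ (minimum _))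
                (x∧y≤y _ _) (trans (x∧y≤x _ _) (reflexive (Eq.sym c≈a)))
    ◁⇒fst-∧≰⊥ pc x (_ , inj₂ (_ , _ , c≈⊤ , _)) y◁x x∧c≤⊥ =
      y◁x (trans (∧-greatest refl (trans (maximum _) (reflexive (Eq.sym c≈⊤))))
                 (trans x∧c≤⊥ (minimum _)))

    weaklyCompossible : IsPseudocomplementation L n → IsReflexive _◁ᴾ_ →
                        ∀ {V} → JoinDense L V → NonZero L V ⊆ D₁ → WeaklyCompossible _◁ᴾ_
    weaklyCompossible pc ◁-refl jd V⊆D₁ x y y◁x =
      let (t , t∈V , t≤x∧y , t≰⊥) = joinDense-witness jd (◁⇒fst-∧≰⊥ pc x y y◁x)
          z = negPair (V⊆D₁ (t∈V , ≰⇒≉⊥ t≰⊥))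
      in z , (λ z-absurd → z-absurd z (◁-refl z))
           , fst≤⇒preRefines z y (trans t≤x∧y (x∧y≤y _ _))
           , fst≤⇒preRefines z x (trans t≤x∧y (x∧y≤x _ _))

theorem4p24 : {ℓ : Level} → ExcludedMiddle ℓ →
    (L : BoundedLattice ℓ ℓ ℓ) →
    (V Λ : Pred (BoundedLattice.Carrier L) ℓ) →
    JoinDense L V → MeetDense L Λ →
    (n : BoundedLattice.Carrier L → BoundedLattice.Carrier L) →
    -- (1)
    (IsPrecomplementation L n →
      EmbeddingResult L n (PairSet L n (Everything L) Λ))
    ×
    -- (2)
    (IsProtocomplementation L n →
      EmbeddingResult L n (PairSet L n (NonZero L (Everything L)) (NonOne L Λ))
      × IsReflexive (_◁_ L {PairSet L n (NonZero L (Everything L)) (NonOne L Λ)}))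
    ×
    -- (3)
    (IsUltraweakPseudocomplementation L n →
      EmbeddingResult L n (PairSet L n V Λ)
      × Pseudosymmetric (_◁_ L {PairSet L n V Λ})
      × ((∀ a → V a) → StronglyPseudosymmetric (_◁_ L {PairSet L n V Λ})))
    ×
    -- (4)
    (IsWeakPseudocomplementation L n →
      EmbeddingResult L n (PairSet L n (NonZero L V) (NonOne L Λ))
      × IsReflexive (_◁_ L {PairSet L n (NonZero L V) (NonOne L Λ)})
      × Pseudosymmetric (_◁_ L {PairSet L n (NonZero L V) (NonOne L Λ)})
      × ((∀ a → V a) →
          StronglyPseudosymmetric (_◁_ L {PairSet L n (NonZero L V) (NonOne L Λ)}))
      × (IsPseudocomplementation L n →
          WeaklyCompossible (_◁_ L {PairSet L n (NonZero L V) (NonOne L Λ)})))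
theorem4p24 em L V Λ jd md n =
    (λ pre → P₁.precomplementation-embeddingResult pre md proj₁ (λ _ → tt) (λ _ → inj₁ tt))
  , (λ pro → P₂.precomplementation-embeddingResult
                 (protocomplementation⇒precomplementation pro) md id id (nonzero-or-neg⊤ pro)
           , P₂.◁-reflexive (proj₁ (proj₂ pro)) proj₂ proj₂)
  , (λ uw → P₃.ultraweak-embeddingResult uw md proj₁ jd proj₁
          , P₃.pseudosymmetric uw jd proj₁
          , λ all-V → P₃.stronglyPseudosymmetric uw λ _ → all-V _)
  , λ weak → let uw = weak⇒ultraweak weak
                 ◁-refl = P₄.◁-reflexive (proj₁ (proj₂ weak)) proj₂ proj₂
             in P₄.ultraweak-embeddingResult uw md id jd id
              , ◁-refl
              , P₄.pseudosymmetric uw jd id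
              , (λ all-V → P₄.stronglyPseudosymmetric uw λ a≉⊥ → all-V _ , a≉⊥)
              , λ pc → P₄.weaklyCompossible pc ◁-refl jd id
  where
  open NegationRepresentation em L n
  module P₁ = PairSetFacts (Everything L) Λ
  module P₂ = PairSetFacts (NonZero L (Everything L)) (NonOne L Λ)
  module P₃ = PairSetFacts V Λ
  module P₄ = PairSetFacts (NonZero L V) (NonOne L Λ)
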